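{- Consider a realization of the directed Chung–Lu random graph with expected degree sequence $(\mathbf{a},\mathbf{b})$ and let $p_{max}=\max_{i,j}p_{ij}$. For every positive integer $r$, $$\Big(\frac{\mathbf{a}\cdot\mathbf{b}}{S}\Big)^{r}-\binom{r}{2}p_{max}\Big(\frac{\mathbf{a}\cdot\mathbf{b}}{S}\Big)^{r-1}\leq E(SC_{r}).$$
   Context: Directed Chung–Lu model: there are $N$ nodes $1,\dots,N$; $\mathbf{a}=(a_1,\dots,a_N)$ and $\mathbf{b}=(b_1,\dots,b_N)$ are nonnegative integer vectors (expected in-degrees and out-degrees) with $S=\sum_i a_i=\sum_i b_i$ and $\max_{i,j}a_ib_j\le S$. For every ordered pair $(i,j)$ (including $i=j$), the directed edge $i\to j$ is present independently with probability $p_{ij}=\frac{b_ia_j}{S}$. $\mathbf{a}\cdot\mathbf{b}=\sum_i a_ib_i$. $SC_r$ denotes the number of simple cycles of length $r$ counted with all cyclic rotations, i.e. the number of $r$-tuples $(i_1,\dots,i_r)$ of pairwise distinct nodes such that the edges $i_1\to i_2,\dots,i_{r-1}\to i_r,i_r\to i_1$ are all present. -}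

module Defs where

open import Data.Bool using (Bool; true; false; if_then_else_; _∨_; _∧_; not)
open import Data.Nat as ℕ using (ℕ; zero; suc; NonZero; _≡ᵇ_)
open import Data.Nat.DivMod using (_mod_)
open import Data.Fin using (Fin; toℕ)
open import Data.List using (List; []; _∷_; map; concatMap; foldr; allFin)
open import Data.Integer using (+_)
open import Data.Rational using (ℚ; _/_; _+_; _*_; _-_; _⊔_; 0ℚ; 1ℚ)

allB : ∀ {A : Set} → (A → Bool) → List A → Bool
allB p = foldr (λ x acc → p x ∧ acc) true

sumℚ : List ℚ → ℚ
sumℚ = foldr _+_ 0ℚ

prodℚ : List ℚ → ℚ
prodℚ = foldr _*_ 1ℚ

maxℚ : List ℚ → ℚ
maxℚ = foldr _⊔_ 0ℚ

_^ℚ_ : ℚ → ℕ → ℚ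
q ^ℚ zero  = 1ℚ
q ^ℚ suc n = q * (q ^ℚ n)

allFunctions : ∀ {A : Set} (n : ℕ) → List A → List (Fin n → A)
allFunctions zero    xs = (λ ()) ∷ []
allFunctions (suc n) xs =
  concatMap (λ x → map (λ f → λ { Fin.zero → x ; (Fin.suc i) → f i }) (allFunctions n xs)) xs

sumℕ : ∀ {N : ℕ} → (Fin N → ℕ) → ℕ
sumℕ {N} f = foldr ℕ._+_ 0 (map f (allFin N))

totalS : ∀ {N : ℕ} → (Fin N → ℕ) → ℕ
totalS = sumℕ

dot : ∀ {N : ℕ} → (Fin N → ℕ) → (Fin N → ℕ) → ℕ
dot a b = sumℕ (λ i → a i ℕ.* b i)

prob : ∀ {N : ℕ} (a b : Fin N → ℕ) (S : ℕ) .{{_ : NonZero S}} → Fin N → Fin N → ℚ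
prob a b S i j = (+ (b i ℕ.* a j)) / S

-- p_max = max_{i,j} p_ij  (all p_ij ≥ 0, so starting the fold at 0 is harmless)
pmax : ∀ {N : ℕ} (a b : Fin N → ℕ) (S : ℕ) .{{_ : NonZero S}} → ℚ
pmax {N} a b S = maxℚ (concatMap (λ i → map (λ j → prob a b S i j) (allFin N)) (allFin N))

-- a realization of the random digraph: G i j = true iff the edge i → j is present
Digraph : ℕ → Set
Digraph N = Fin N → Fin N → Bool

allDigraphs : (N : ℕ) → List (Digraph N)
allDigraphs N = allFunctions N (allFunctions N (true ∷ false ∷ []))

probDigraph : ∀ {N : ℕ} (a b : Fin N → ℕ) (S : ℕ) .{{_ : NonZero S}} → Digraph N → ℚ
probDigraph {N} a b S G =
  prodℚ (concatMap (λ i → map (λ j → if G i j then prob a b S i j else 1ℚ - prob a b S i j)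
                              (allFin N)) (allFin N))

nextCyc : ∀ {r : ℕ} .{{_ : NonZero r}} → Fin r → Fin r
nextCyc {r} k = suc (toℕ k) mod r

isSimpleCycle : ∀ {N r : ℕ} .{{_ : NonZero r}} → Digraph N → (Fin r → Fin N) → Bool
isSimpleCycle {N} {r} G t =
  allB (λ k → allB (λ l → (toℕ k ≡ᵇ toℕ l) ∨ not (toℕ (t k) ≡ᵇ toℕ (t l))) (allFin r)) (allFin r)
  ∧ allB (λ k → G (t k) (t (nextCyc k))) (allFin r)

-- SC_r(G): number of simple r-cycles counted with all rotations
SC : ∀ {N : ℕ} (r : ℕ) .{{_ : NonZero r}} → Digraph N → ℕ
SC {N} r G = foldr ℕ._+_ 0 (map (λ t → if isSimpleCycle G t then 1 else 0) (allFunctions r (allFin N)))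

expectedSC : ∀ {N : ℕ} (a b : Fin N → ℕ) (S : ℕ) .{{_ : NonZero S}} (r : ℕ) .{{_ : NonZero r}} → ℚ
expectedSC {N} a b S r =
  sumℚ (map (λ G → probDigraph a b S G * ((+ SC r G) / 1)) (allDigraphs N))

module Submission where

-- Put w i = p_ii = a_i b_i / S, so ρ := Σ_i w i = a·b/S and every
-- w i ≤ p_max =: m.  For any r pairs (u k, v k), P(all edges u k → v k present)
--      ≥ ∏_k p(u k)(v k); pairs occurring several times only increase the left side.
--      The sum over all digraphs factorises over node pairs (discrete Fubini), and
--      a pair of multiplicity c contributes p ≥ p^c (or 1 = p^0).
--  (2) Rotation.  Along a closed walk t, ∏_k p(t k)(t (k+1)) = ∏_k b(t k) a(t (k+1)) / S
--      = ∏_k w(t k), since the a-factors are only cyclically shifted.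
--  Hence E(SC_r) ≥ D r, where D n is the sum of ∏_k w(t k) over injective n-tuples t.
--  (3) Counting.  Prepending x to an injective f keeps it injective unless x occurs
--      in f, which gives ρ D n ≤ D (n+1) + n m ρ^n, and by induction
--      D r ≥ ρ^r − C(r,2) m ρ^(r−1).

open import Defs
open import Data.Nat as ℕ using (ℕ; zero; suc; NonZero; _≤_; _∸_; _≡ᵇ_)
open import Data.Nat.Combinatorics using (_C_; nC1≡n; nCk+nC[k+1]≡[n+1]C[k+1])
import Data.Nat.Properties as NP
import Data.Nat.DivMod as DM
open import Data.Fin as F using (Fin; toℕ)
import Data.Fin.Properties as FP
open import Data.Bool using (Bool; true; false; if_then_else_; _∧_; _∨_; not)
open import Data.List using (List; []; _∷_; map; foldr; tabulate; allFin; _++_; concatMap)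
open import Data.List.Membership.Propositional using (_∈_)
open import Data.List.Membership.Propositional.Properties using (∈-allFin; ∈-map⁺; ∈-concat⁺′)
open import Data.List.Relation.Unary.Any using (here; there)
open import Data.Integer as ℤ using (ℤ; +_)
import Data.Integer.Properties as ZP
open import Data.Integer.Solver using (module +-*-Solver)
open import Data.Rational using (ℚ; _/_; _*_; _-_; _+_; -_; 0ℚ; 1ℚ; toℚᵘ; nonNegative)
  renaming (_≤_ to _≤ℚ_)
import Data.Rational.Properties as QP
import Data.Rational.Unnormalised as U
import Data.Rational.Unnormalised.Properties as UP
open import Algebra.Bundles using (CommutativeRing)
open import Algebra.Properties.Semiring.Sum (CommutativeRing.semiring QP.+-*-commutativeRing)
  using (sum; sum-syntax; ∑-comm; sum-cong-≗; sum-replicate-zero; *-distribʳ-sum)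
open import Algebra.Properties.CommutativeMonoid.Sum QP.*-1-commutativeMonoid
  using () renaming (sum to prod; sum-cong-≗ to prod-cong; sum-replicate-zero to prod-one;
                     ∑-distrib-+ to prod-distrib-*; ∑-comm to prod-comm; sum-init-last to prod-init-last)
import Algebra.Solver.Ring.Simple as RingSolver
import Algebra.Solver.Ring.AlmostCommutativeRing as ACR
open import Function using (_∘_; id)
open import Relation.Binary.PropositionalEquality

-- Natural numbers as fractions with a fixed nonzero denominator d.  The proofs go
-- through the unnormalised rationals, where i / suc s is literally mkℚᵘ i s.
toℚᵘ-/ : ∀ (i : ℤ) s → toℚᵘ (i / suc s) U.≃ U.mkℚᵘ i s
toℚᵘ-/ i s = QP.toℚᵘ-fromℚᵘ (U.mkℚᵘ i s)

frac-+ : ∀ m n d .{{_ : NonZero d}} → (+ (m ℕ.+ n)) / d ≡ (+ m) / d + (+ n) / d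
frac-+ m n (suc s) = QP.toℚᵘ-injective (begin
  toℚᵘ ((+ (m ℕ.+ n)) / suc s)                    ≈⟨ toℚᵘ-/ (+ (m ℕ.+ n)) s ⟩
  U.mkℚᵘ (+ m ℤ.+ + n) s                          ≈⟨ U.*≡* (cross-multiply (+ m) (+ n) (+ suc s)) ⟩
  U.mkℚᵘ (+ m) s U.+ U.mkℚᵘ (+ n) s               ≈⟨ UP.+-cong (toℚᵘ-/ (+ m) s) (toℚᵘ-/ (+ n) s) ⟨
  toℚᵘ ((+ m) / suc s) U.+ toℚᵘ ((+ n) / suc s)   ≈⟨ QP.toℚᵘ-homo-+ ((+ m) / suc s) ((+ n) / suc s) ⟨
  toℚᵘ ((+ m) / suc s + (+ n) / suc s)            ∎)
  where
  open UP.≃-Reasoning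
  open +-*-Solver
  cross-multiply : ∀ m n d → (m ℤ.+ n) ℤ.* (d ℤ.* d) ≡ (m ℤ.* d ℤ.+ n ℤ.* d) ℤ.* d
  cross-multiply = solve 3 (λ m n d → (m :+ n) :* (d :* d) := (m :* d :+ n :* d) :* d) refl

frac-* : ∀ m n d .{{_ : NonZero d}} → (+ (m ℕ.* n)) / d ≡ (+ m) / d * ((+ n) / 1)
frac-* m n (suc s) = QP.toℚᵘ-injective (begin
  toℚᵘ ((+ (m ℕ.* n)) / suc s)                    ≈⟨ toℚᵘ-/ (+ (m ℕ.* n)) s ⟩
  U.mkℚᵘ (+ (m ℕ.* n)) s                          ≡⟨ cong (λ i → U.mkℚᵘ i s) (ZP.pos-* m n) ⟩
  U.mkℚᵘ (+ m ℤ.* + n) s                          ≈⟨ U.*≡* (cong ((+ m ℤ.* + n) ℤ.*_) (ZP.*-identityʳ (+ suc s))) ⟩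
  U.mkℚᵘ (+ m) s U.* U.mkℚᵘ (+ n) 0               ≈⟨ UP.*-cong (toℚᵘ-/ (+ m) s) (toℚᵘ-/ (+ n) 0) ⟨
  toℚᵘ ((+ m) / suc s) U.* toℚᵘ ((+ n) / 1)       ≈⟨ QP.toℚᵘ-homo-* ((+ m) / suc s) ((+ n) / 1) ⟨
  toℚᵘ ((+ m) / suc s * ((+ n) / 1))                ∎)
  where open UP.≃-Reasoning

frac-≤1 : ∀ m d .{{_ : NonZero d}} → m ≤ d → (+ m) / d ≤ℚ 1ℚ
frac-≤1 m (suc s) m≤d = QP.toℚᵘ-cancel-≤ (UP.≤-respˡ-≃ (UP.≃-sym (toℚᵘ-/ (+ m) s))
  (U.*≤* (subst₂ ℤ._≤_ (sym (ZP.*-identityʳ (+ m))) (sym (ZP.*-identityˡ (+ suc s))) (ℤ.+≤+ m≤d))))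

frac-nonneg : ∀ m d .{{_ : NonZero d}} → 0ℚ ≤ℚ (+ m) / d
frac-nonneg m d = QP.nonNegative⁻¹ _ {{QP.normalize-nonNeg m d}}

open RingSolver (ACR.fromCommutativeRing QP.+-*-commutativeRing) QP._≟_
  using (solve; _:+_; _:*_; _:-_; _:=_; con)

*-monoˡ-nonneg : ∀ {r p q : ℚ} → 0ℚ ≤ℚ r → p ≤ℚ q → r * p ≤ℚ r * q
*-monoˡ-nonneg {r} r≥0 = QP.*-monoˡ-≤-nonNeg r {{nonNegative r≥0}}

*-monoʳ-nonneg : ∀ {r p q : ℚ} → 0ℚ ≤ℚ r → p ≤ℚ q → p * r ≤ℚ q * r
*-monoʳ-nonneg {r} r≥0 = QP.*-monoʳ-≤-nonNeg r {{nonNegative r≥0}}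

*-nonneg : ∀ {p q : ℚ} → 0ℚ ≤ℚ p → 0ℚ ≤ℚ q → 0ℚ ≤ℚ p * q
*-nonneg {p} p≥0 q≥0 = QP.≤-trans (QP.≤-reflexive (sym (QP.*-zeroʳ p))) (*-monoˡ-nonneg p≥0 q≥0)

*-mono-nonneg : ∀ {a b c d : ℚ} → 0ℚ ≤ℚ a → a ≤ℚ b → 0ℚ ≤ℚ c → c ≤ℚ d → a * c ≤ℚ b * d
*-mono-nonneg a≥0 a≤b c≥0 c≤d =
  QP.≤-trans (*-monoˡ-nonneg a≥0 c≤d) (*-monoʳ-nonneg (QP.≤-trans c≥0 c≤d) a≤b)

≤-+⇒-≤ : ∀ {a b c : ℚ} → a ≤ℚ b + c → a - c ≤ℚ b
≤-+⇒-≤ {a} {b} {c} a≤b+c = QP.≤-trans (QP.+-monoˡ-≤ (- c) a≤b+c)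
  (QP.≤-reflexive (solve 2 (λ b c → b :+ c :- c := b) refl b c))

prod-syntax : ∀ n → (Fin n → ℚ) → ℚ
prod-syntax _ = prod

syntax prod-syntax n (λ i → x) = ∏[ i < n ] x

prod-const : ∀ n c → ∏[ i < n ] c ≡ c ^ℚ n
prod-const zero    c = refl
prod-const (suc n) c = cong (c *_) (prod-const n c)

prod-nonneg : ∀ {n} (f : Fin n → ℚ) → (∀ i → 0ℚ ≤ℚ f i) → 0ℚ ≤ℚ prod f
prod-nonneg {zero}  f f≥0 = QP.nonNegative⁻¹ 1ℚ
prod-nonneg {suc n} f f≥0 = *-nonneg (f≥0 F.zero) (prod-nonneg (f ∘ F.suc) (f≥0 ∘ F.suc))

prod-mono : ∀ {n} (f g : Fin n → ℚ) → (∀ i → 0ℚ ≤ℚ f i) → (∀ i → f i ≤ℚ g i) → prod f ≤ℚ prod g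
prod-mono {zero}  f g f≥0 f≤g = QP.≤-refl
prod-mono {suc n} f g f≥0 f≤g =
  *-mono-nonneg (f≥0 F.zero) (f≤g F.zero) (prod-nonneg (f ∘ F.suc) (f≥0 ∘ F.suc))
                (prod-mono (f ∘ F.suc) (g ∘ F.suc) (f≥0 ∘ F.suc) (f≤g ∘ F.suc))

∑-mono : ∀ {n} (f g : Fin n → ℚ) → (∀ i → f i ≤ℚ g i) → sum f ≤ℚ sum g
∑-mono {zero}  f g f≤g = QP.≤-refl
∑-mono {suc n} f g f≤g = QP.+-mono-≤ (f≤g F.zero) (∑-mono (f ∘ F.suc) (g ∘ F.suc) (f≤g ∘ F.suc))

∑-nonneg : ∀ {n} (f : Fin n → ℚ) → (∀ i → 0ℚ ≤ℚ f i) → 0ℚ ≤ℚ sum f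
∑-nonneg {zero}  f f≥0 = QP.≤-refl
∑-nonneg {suc n} f f≥0 = QP.+-mono-≤ (f≥0 F.zero) (∑-nonneg (f ∘ F.suc) (f≥0 ∘ F.suc))

lsum : ∀ {A : Set} → List A → (A → ℚ) → ℚ
lsum xs f = sumℚ (map f xs)

syntax lsum xs (λ x → e) = ∑[ x ∈ xs ] e

lsum-cong : ∀ {A : Set} (xs : List A) {f g : A → ℚ} → (∀ x → f x ≡ g x) → lsum xs f ≡ lsum xs g
lsum-cong []       f≗g = refl
lsum-cong (x ∷ xs) f≗g = cong₂ _+_ (f≗g x) (lsum-cong xs f≗g)

lsum-mono : ∀ {A : Set} (xs : List A) {f g : A → ℚ} → (∀ x → f x ≤ℚ g x) → lsum xs f ≤ℚ lsum xs g
lsum-mono []       f≤g = QP.≤-refl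
lsum-mono (x ∷ xs) f≤g = QP.+-mono-≤ (f≤g x) (lsum-mono xs f≤g)

lsum-distrib-+ : ∀ {A : Set} (xs : List A) (f g : A → ℚ) →
                 ∑[ x ∈ xs ] (f x + g x) ≡ lsum xs f + lsum xs g
lsum-distrib-+ []       f g = sym (QP.+-identityˡ 0ℚ)
lsum-distrib-+ (x ∷ xs) f g =
  trans (cong (λ z → (f x + g x) + z) (lsum-distrib-+ xs f g))
        (solve 4 (λ a b c d → (a :+ b) :+ (c :+ d) := (a :+ c) :+ (b :+ d)) refl
               (f x) (g x) (lsum xs f) (lsum xs g))

lsum-*ˡ : ∀ {A : Set} (xs : List A) c (f : A → ℚ) → ∑[ x ∈ xs ] (c * f x) ≡ c * lsum xs f
lsum-*ˡ []       c f = sym (QP.*-zeroʳ c)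
lsum-*ˡ (x ∷ xs) c f = trans (cong (λ z → c * f x + z) (lsum-*ˡ xs c f)) (sym (QP.*-distribˡ-+ c (f x) _))

lsum-zero : ∀ {A : Set} (xs : List A) → ∑[ x ∈ xs ] 0ℚ ≡ 0ℚ
lsum-zero []       = refl
lsum-zero (x ∷ xs) = trans (QP.+-identityˡ _) (lsum-zero xs)

lsum-comm : ∀ {A B : Set} (xs : List A) (ys : List B) (f : A → B → ℚ) →
            ∑[ x ∈ xs ] lsum ys (f x) ≡ ∑[ y ∈ ys ] ∑[ x ∈ xs ] f x y
lsum-comm []       ys f = sym (lsum-zero ys)
lsum-comm (x ∷ xs) ys f = trans (cong (λ z → lsum ys (f x) + z) (lsum-comm xs ys f))
                                (sym (lsum-distrib-+ ys (f x) (λ y → ∑[ x′ ∈ xs ] f x′ y)))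

lsum-allFin : ∀ n (f : Fin n → ℚ) → lsum (allFin n) f ≡ ∑[ i < n ] f i
lsum-allFin n f = lsum-tabulate n id
  where
  lsum-tabulate : ∀ m (h : Fin m → Fin n) → lsum (tabulate h) f ≡ ∑[ i < m ] f (h i)
  lsum-tabulate zero    h = refl
  lsum-tabulate (suc m) h = cong (λ z → f (h F.zero) + z) (lsum-tabulate m (h ∘ F.suc))

lsum-map : ∀ {A B : Set} (h : A → B) (xs : List A) (f : B → ℚ) → lsum (map h xs) f ≡ ∑[ x ∈ xs ] f (h x)
lsum-map h []       f = refl
lsum-map h (x ∷ xs) f = cong (λ z → f (h x) + z) (lsum-map h xs f)

lsum-concatMap : ∀ {A B : Set} (h : A → List B) (xs : List A) (f : B → ℚ) →
                 lsum (concatMap h xs) f ≡ ∑[ x ∈ xs ] lsum (h x) f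
lsum-concatMap h []       f = refl
lsum-concatMap h (x ∷ xs) f = trans (lsum-++ (h x) (concatMap h xs)) (cong (λ z → lsum (h x) f + z) (lsum-concatMap h xs f))
  where
  lsum-++ : ∀ ys zs → lsum (ys ++ zs) f ≡ lsum ys f + lsum zs f
  lsum-++ []       zs = sym (QP.+-identityˡ _)
  lsum-++ (y ∷ ys) zs = trans (cong (λ z → f y + z) (lsum-++ ys zs)) (sym (QP.+-assoc (f y) _ _))

-- The summand is written through (t zero) and (t ∘ suc) since Defs builds the
-- functions by an anonymous pattern-matching lambda.
lsum-allFunctions-suc : ∀ {A : Set} n (xs : List A) (F : A → (Fin n → A) → ℚ) →
  ∑[ t ∈ allFunctions (suc n) xs ] F (t F.zero) (t ∘ F.suc) ≡ ∑[ x ∈ xs ] ∑[ f ∈ allFunctions n xs ] F x f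
lsum-allFunctions-suc n xs F =
  trans (lsum-concatMap _ xs _) (lsum-cong xs (λ x → lsum-map _ (allFunctions n xs) _))

lsum-allFunctions-prod : ∀ {A : Set} n (xs : List A) (g : Fin n → A → ℚ) →
  ∑[ f ∈ allFunctions n xs ] ∏[ i < n ] g i (f i) ≡ ∏[ i < n ] lsum xs (g i)
lsum-allFunctions-prod zero    xs g = QP.+-identityʳ 1ℚ
lsum-allFunctions-prod {A} (suc n) xs g = begin
  ∑[ f ∈ allFunctions (suc n) xs ] ∏[ i < suc n ] g i (f i)
    ≡⟨ lsum-allFunctions-suc n xs (λ x f → g F.zero x * ∏[ i < n ] g (F.suc i) (f i)) ⟩
  ∑[ x ∈ xs ] ∑[ f ∈ fs ] (g F.zero x * ∏[ i < n ] g (F.suc i) (f i))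
    ≡⟨ lsum-cong xs (λ x → lsum-*ˡ fs (g F.zero x) _) ⟩
  ∑[ x ∈ xs ] (g F.zero x * ∑[ f ∈ fs ] ∏[ i < n ] g (F.suc i) (f i))
    ≡⟨ lsum-cong xs (λ x → cong (g F.zero x *_) (lsum-allFunctions-prod n xs (g ∘ F.suc))) ⟩
  ∑[ x ∈ xs ] (g F.zero x * rest)
    ≡⟨ lsum-cong xs (λ x → QP.*-comm (g F.zero x) rest) ⟩
  ∑[ x ∈ xs ] (rest * g F.zero x)
    ≡⟨ lsum-*ˡ xs rest (g F.zero) ⟩
  rest * lsum xs (g F.zero)
    ≡⟨ QP.*-comm rest _ ⟩
  lsum xs (g F.zero) * rest ∎
  where
  open ≡-Reasoning
  fs : List (Fin n → A)
  fs = allFunctions n xs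
  rest : ℚ
  rest = ∏[ i < n ] lsum xs (g (F.suc i))

frac-sum : ∀ {A : Set} (g : A → ℕ) (xs : List A) d .{{_ : NonZero d}} →
           (+ foldr ℕ._+_ 0 (map g xs)) / d ≡ ∑[ x ∈ xs ] ((+ g x) / d)
frac-sum g []       d = QP.0/n≡0 d
frac-sum g (x ∷ xs) d = trans (frac-+ (g x) _ d) (cong (λ z → (+ g x) / d + z) (frac-sum g xs d))

prodℚ-allFin : ∀ n (f : Fin n → ℚ) → prodℚ (map f (allFin n)) ≡ ∏[ i < n ] f i
prodℚ-allFin n f = prodℚ-tabulate n id
  where
  prodℚ-tabulate : ∀ m (h : Fin m → Fin n) → prodℚ (map f (tabulate h)) ≡ ∏[ i < m ] f (h i)
  prodℚ-tabulate zero    h = refl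
  prodℚ-tabulate (suc m) h = cong (f (h F.zero) *_) (prodℚ-tabulate m (h ∘ F.suc))

prodℚ-concatMap : ∀ {A : Set} (h : A → List ℚ) (xs : List A) →
                  prodℚ (concatMap h xs) ≡ prodℚ (map (prodℚ ∘ h) xs)
prodℚ-concatMap h []       = refl
prodℚ-concatMap h (x ∷ xs) = trans (prodℚ-++ (h x) (concatMap h xs)) (cong (prodℚ (h x) *_) (prodℚ-concatMap h xs))
  where
  prodℚ-++ : ∀ ys zs → prodℚ (ys ++ zs) ≡ prodℚ ys * prodℚ zs
  prodℚ-++ []       zs = sym (QP.*-identityˡ _)
  prodℚ-++ (y ∷ ys) zs = trans (cong (y *_) (prodℚ-++ ys zs)) (sym (QP.*-assoc y _ _))

prodℚ-grid : ∀ m n (f : Fin m → Fin n → ℚ) →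
             prodℚ (concatMap (λ i → map (f i) (allFin n)) (allFin m)) ≡ ∏[ i < m ] ∏[ j < n ] f i j
prodℚ-grid m n f = trans (prodℚ-concatMap (λ i → map (f i) (allFin n)) (allFin m))
                         (trans (prodℚ-allFin m (λ i → prodℚ (map (f i) (allFin n))))
                                (prod-cong (λ i → prodℚ-allFin n (f i))))

maxℚ-≥ : ∀ {y} (xs : List ℚ) → y ∈ xs → y ≤ℚ maxℚ xs
maxℚ-≥ (x ∷ xs) (here refl)  = QP.p≤p⊔q x _
maxℚ-≥ (x ∷ xs) (there y∈xs) = QP.≤-trans (maxℚ-≥ xs y∈xs) (QP.p≤q⊔p x _)

ι : Bool → ℚ
ι true  = 1ℚ
ι false = 0ℚ

ι-∧ : ∀ c d → ι (c ∧ d) ≡ ι c * ι d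
ι-∧ true  d = sym (QP.*-identityˡ (ι d))
ι-∧ false d = sym (QP.*-zeroˡ (ι d))

ι-nonneg : ∀ c → 0ℚ ≤ℚ ι c
ι-nonneg true  = QP.nonNegative⁻¹ 1ℚ
ι-nonneg false = QP.≤-refl

ι-≤1 : ∀ c → ι c ≤ℚ 1ℚ
ι-≤1 true  = QP.≤-refl
ι-≤1 false = QP.nonNegative⁻¹ 1ℚ

allᶠ : ∀ {n} → (Fin n → Bool) → Bool
allᶠ {zero}  c = true
allᶠ {suc n} c = c F.zero ∧ allᶠ (c ∘ F.suc)

allᶠ-cong : ∀ {n} {c d : Fin n → Bool} → (∀ k → c k ≡ d k) → allᶠ c ≡ allᶠ d
allᶠ-cong {zero}  c≗d = refl
allᶠ-cong {suc n} c≗d = cong₂ _∧_ (c≗d F.zero) (allᶠ-cong (c≗d ∘ F.suc))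

allᶠ-∧ : ∀ {n} (c d : Fin n → Bool) → allᶠ (λ k → c k ∧ d k) ≡ allᶠ c ∧ allᶠ d
allᶠ-∧ {zero}  c d = refl
allᶠ-∧ {suc n} c d with c F.zero | d F.zero
... | true  | true  = allᶠ-∧ (c ∘ F.suc) (d ∘ F.suc)
... | true  | false = sym (∧-false (allᶠ (c ∘ F.suc)))
  where ∧-false : ∀ x → (x ∧ false) ≡ false
        ∧-false true  = refl
        ∧-false false = refl
... | false | _     = refl

ι-allᶠ : ∀ {n} (c : Fin n → Bool) → ι (allᶠ c) ≡ ∏[ k < n ] ι (c k)
ι-allᶠ {zero}  c = refl
ι-allᶠ {suc n} c = trans (ι-∧ (c F.zero) _) (cong (ι (c F.zero) *_) (ι-allᶠ (c ∘ F.suc)))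

allB-allFin : ∀ n (c : Fin n → Bool) → allB c (allFin n) ≡ allᶠ c
allB-allFin n c = allB-tabulate n id
  where
  allB-tabulate : ∀ m (h : Fin m → Fin n) → allB c (tabulate h) ≡ allᶠ (c ∘ h)
  allB-tabulate zero    h = refl
  allB-tabulate (suc m) h = cong (c (h F.zero) ∧_) (allB-tabulate m (h ∘ F.suc))

none-false⇒count≥1 : ∀ {n} (c : Fin n → Bool) → allᶠ (λ k → not (c k)) ≡ false →
                     1ℚ ≤ℚ ∑[ k < n ] ι (c k)
none-false⇒count≥1 {suc n} c all≡false with c F.zero
... | true  = QP.≤-trans (QP.≤-reflexive (sym (QP.+-identityʳ 1ℚ)))
                         (QP.+-monoʳ-≤ 1ℚ (∑-nonneg _ (λ k → ι-nonneg (c (F.suc k)))))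
... | false = QP.≤-trans (none-false⇒count≥1 (c ∘ F.suc) all≡false)
                         (QP.≤-reflexive (sym (QP.+-identityˡ _)))

eqF : ∀ {n} → Fin n → Fin n → Bool
eqF i j = toℕ i ≡ᵇ toℕ j

eqF-sym : ∀ {n} (i j : Fin n) → eqF i j ≡ eqF j i
eqF-sym i j = ≡ᵇ-sym (toℕ i) (toℕ j)
  where
  ≡ᵇ-sym : ∀ m n → (m ≡ᵇ n) ≡ (n ≡ᵇ m)
  ≡ᵇ-sym zero    zero    = refl
  ≡ᵇ-sym zero    (suc n) = refl
  ≡ᵇ-sym (suc m) zero    = refl
  ≡ᵇ-sym (suc m) (suc n) = ≡ᵇ-sym m n

∑-point : ∀ {n} (u : Fin n) (g : Fin n → ℚ) → ∑[ i < n ] (ι (eqF u i) * g i) ≡ g u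
∑-point {suc n} F.zero    g = begin
  1ℚ * g F.zero + ∑[ i < n ] (0ℚ * g (F.suc i))
    ≡⟨ cong₂ _+_ (QP.*-identityˡ (g F.zero)) (sum-cong-≗ {y = λ _ → 0ℚ} (λ i → QP.*-zeroˡ (g (F.suc i)))) ⟩
  g F.zero + ∑[ i < n ] 0ℚ                       ≡⟨ cong (λ z → g F.zero + z) (sum-replicate-zero n) ⟩
  g F.zero + 0ℚ                                  ≡⟨ QP.+-identityʳ _ ⟩
  g F.zero                                       ∎
  where open ≡-Reasoning
∑-point {suc n} (F.suc u) g =
  trans (cong (λ z → z + ∑[ i < n ] (ι (eqF u i) * g (F.suc i))) (QP.*-zeroˡ (g F.zero)))
        (trans (QP.+-identityˡ _) (∑-point u (g ∘ F.suc)))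

-- select c x is x if c holds and 1 otherwise, so ∏_k select (c k) x = x ^ #{k | c k}.
select : Bool → ℚ → ℚ
select c x = if c then x else 1ℚ

select-nonneg : ∀ c {x} → 0ℚ ≤ℚ x → 0ℚ ≤ℚ select c x
select-nonneg true  x≥0 = x≥0
select-nonneg false x≥0 = QP.nonNegative⁻¹ 1ℚ

select-≤1 : ∀ c {x} → x ≤ℚ 1ℚ → select c x ≤ℚ 1ℚ
select-≤1 true  x≤1 = x≤1
select-≤1 false x≤1 = QP.≤-refl

select-one : ∀ {n} (c : Fin n → Bool) → ∏[ k < n ] select (c k) 1ℚ ≡ 1ℚ
select-one {n} c = trans (prod-cong (λ k → select-1 (c k))) (prod-one n)
  where
  select-1 : ∀ b → select b 1ℚ ≡ 1ℚ
  select-1 true  = refl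
  select-1 false = refl

-- For 0 ≤ x ≤ 1 and any multiplicity μ:  x ^ μ ≤ x + (1 − x) · 0 ^ μ
-- (an equality for μ ≤ 1; this is where repeated edges are handled).
power-bound : ∀ {n} (c : Fin n → Bool) {x} → 0ℚ ≤ℚ x → x ≤ℚ 1ℚ →
  ∏[ k < n ] select (c k) x ≤ℚ x + (1ℚ - x) * ∏[ k < n ] select (c k) 0ℚ
power-bound {zero} c {x} x≥0 x≤1 =
  QP.≤-reflexive (solve 1 (λ x → con 1ℚ := x :+ (con 1ℚ :- x) :* con 1ℚ) refl x)
power-bound {suc n} c {x} x≥0 x≤1 with c F.zero
... | true = begin
  x * ∏[ k < n ] select (c (F.suc k)) x     ≤⟨ *-monoˡ-nonneg x≥0 rest≤1 ⟩
  x * 1ℚ                                     ≡⟨ solve 2 (λ x z → x :* con 1ℚ := x :+ (con 1ℚ :- x) :* (con 0ℚ :* z))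
                                                        refl x (∏[ k < n ] select (c (F.suc k)) 0ℚ) ⟩
  x + (1ℚ - x) * (0ℚ * ∏[ k < n ] select (c (F.suc k)) 0ℚ) ∎
  where
  open QP.≤-Reasoning
  rest≤1 : ∏[ k < n ] select (c (F.suc k)) x ≤ℚ 1ℚ
  rest≤1 = QP.≤-trans (prod-mono _ _ (λ k → select-nonneg (c (F.suc k)) x≥0)
                                      (λ k → select-≤1 (c (F.suc k)) x≤1))
                      (QP.≤-reflexive (prod-one n))
... | false = begin
  1ℚ * ∏[ k < n ] select (c (F.suc k)) x     ≡⟨ QP.*-identityˡ _ ⟩
  ∏[ k < n ] select (c (F.suc k)) x          ≤⟨ power-bound (c ∘ F.suc) x≥0 x≤1 ⟩
  x + (1ℚ - x) * ∏[ k < n ] select (c (F.suc k)) 0ℚ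
      ≡⟨ cong (λ z → x + (1ℚ - x) * z) (sym (QP.*-identityˡ _)) ⟩
  x + (1ℚ - x) * (1ℚ * ∏[ k < n ] select (c (F.suc k)) 0ℚ) ∎
  where open QP.≤-Reasoning

select-point : ∀ {n} (u : Fin n) (g : Fin n → ℚ) → ∏[ i < n ] select (eqF u i) (g i) ≡ g u
select-point {suc n} F.zero    g = trans (cong (g F.zero *_) (prod-one n)) (QP.*-identityʳ (g F.zero))
select-point {suc n} (F.suc u) g = trans (QP.*-identityˡ _) (select-point u (g ∘ F.suc))

select-point₂ : ∀ {N} (u v : Fin N) (X : Fin N → Fin N → ℚ) →
                ∏[ i < N ] ∏[ j < N ] select (eqF u i ∧ eqF v j) (X i j) ≡ X u v
select-point₂ {N} u v X = trans (prod-cong (λ i → row (eqF u i) (X i))) (select-point u (λ i → X i v))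
  where
  row : ∀ c (Y : Fin N → ℚ) → ∏[ j < N ] select (c ∧ eqF v j) (Y j) ≡ select c (Y v)
  row true  Y = select-point v Y
  row false Y = prod-one N

-- For r ordered pairs (u k, v k): does the k-th pair equal (i , j)?  Then
-- pairPower u v i j x = x ^ (multiplicity of (i , j) among the pairs).
hits : ∀ {r N} → (Fin r → Fin N) → (Fin r → Fin N) → Fin N → Fin N → Fin r → Bool
hits u v i j k = eqF (u k) i ∧ eqF (v k) j

pairPower : ∀ {r N} → (Fin r → Fin N) → (Fin r → Fin N) → Fin N → Fin N → ℚ → ℚ
pairPower {r} u v i j x = ∏[ k < r ] select (hits u v i j k) x

prod-regroup : ∀ {r N} (u v : Fin r → Fin N) (X : Fin N → Fin N → ℚ) →
               ∏[ k < r ] X (u k) (v k) ≡ ∏[ i < N ] ∏[ j < N ] pairPower u v i j (X i j)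
prod-regroup {r} {N} u v X = begin
  ∏[ k < r ] X (u k) (v k)
    ≡⟨ prod-cong (λ k → sym (select-point₂ (u k) (v k) X)) ⟩
  ∏[ k < r ] ∏[ i < N ] ∏[ j < N ] select (eqF (u k) i ∧ eqF (v k) j) (X i j)
    ≡⟨ prod-comm (λ k i → ∏[ j < N ] select (eqF (u k) i ∧ eqF (v k) j) (X i j)) ⟩
  ∏[ i < N ] ∏[ k < r ] ∏[ j < N ] select (eqF (u k) i ∧ eqF (v k) j) (X i j)
    ≡⟨ prod-cong (λ i → prod-comm (λ k j → select (eqF (u k) i ∧ eqF (v k) j) (X i j))) ⟩
  ∏[ i < N ] ∏[ j < N ] pairPower u v i j (X i j) ∎
  where open ≡-Reasoning

module EdgeIndependence {N : ℕ} (p : Fin N → Fin N → ℚ) where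

  edgeFactor : Fin N → Fin N → Bool → ℚ
  edgeFactor i j e = if e then p i j else 1ℚ - p i j

  weight : Digraph N → ℚ
  weight G = ∏[ i < N ] ∏[ j < N ] edgeFactor i j (G i j)

  allPresent-prob : ∀ {r} (u v : Fin r → Fin N) →
    ∑[ G ∈ allDigraphs N ] (weight G * ι (allᶠ (λ k → G (u k) (v k))))
      ≡ ∏[ i < N ] ∏[ j < N ] (p i j * pairPower u v i j 1ℚ + ((1ℚ - p i j) * pairPower u v i j 0ℚ + 0ℚ))
  allPresent-prob {r} u v = begin
    ∑[ G ∈ allDigraphs N ] (weight G * ι (allᶠ (λ k → G (u k) (v k))))
      ≡⟨ lsum-cong (allDigraphs N) factorise ⟩
    ∑[ G ∈ allDigraphs N ] ∏[ i < N ] ∏[ j < N ] H i j (G i j)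
      ≡⟨ lsum-allFunctions-prod N rows (λ i row → ∏[ j < N ] H i j (row j)) ⟩
    ∏[ i < N ] ∑[ row ∈ rows ] ∏[ j < N ] H i j (row j)
      ≡⟨ prod-cong (λ i → lsum-allFunctions-prod N bools (H i)) ⟩
    ∏[ i < N ] ∏[ j < N ] lsum bools (H i j) ∎
    where
    open ≡-Reasoning
    bools : List Bool
    bools = true ∷ false ∷ []
    rows : List (Fin N → Bool)
    rows = allFunctions N bools
    H : Fin N → Fin N → Bool → ℚ
    H i j e = edgeFactor i j e * pairPower u v i j (ι e)
    factorise : ∀ G → weight G * ι (allᶠ (λ k → G (u k) (v k))) ≡ ∏[ i < N ] ∏[ j < N ] H i j (G i j)
    factorise G = begin
      weight G * ι (allᶠ (λ k → G (u k) (v k)))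
        ≡⟨ cong (weight G *_) (trans (ι-allᶠ (λ k → G (u k) (v k))) (prod-regroup u v (λ i j → ι (G i j)))) ⟩
      weight G * ∏[ i < N ] ∏[ j < N ] pairPower u v i j (ι (G i j))
        ≡⟨ prod-distrib-* (λ i → ∏[ j < N ] edgeFactor i j (G i j))
                               (λ i → ∏[ j < N ] pairPower u v i j (ι (G i j))) ⟨
      ∏[ i < N ] (∏[ j < N ] edgeFactor i j (G i j) * ∏[ j < N ] pairPower u v i j (ι (G i j)))
        ≡⟨ prod-cong (λ i → prod-distrib-* (λ j → edgeFactor i j (G i j))
                                                 (λ j → pairPower u v i j (ι (G i j)))) ⟨
      ∏[ i < N ] ∏[ j < N ] H i j (G i j) ∎

  allPresent-≥ : (∀ i j → 0ℚ ≤ℚ p i j) → (∀ i j → p i j ≤ℚ 1ℚ) → ∀ {r} (u v : Fin r → Fin N) →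
    ∏[ k < r ] p (u k) (v k) ≤ℚ ∑[ G ∈ allDigraphs N ] (weight G * ι (allᶠ (λ k → G (u k) (v k))))
  allPresent-≥ p≥0 p≤1 {r} u v = begin
    ∏[ k < r ] p (u k) (v k)
      ≡⟨ prod-regroup u v p ⟩
    ∏[ i < N ] ∏[ j < N ] pairPower u v i j (p i j)
      ≤⟨ prod-mono _ _ (λ i → prod-nonneg _ (λ j → power-nonneg i j))
                       (λ i → prod-mono _ _ (λ j → power-nonneg i j)
                                            (λ j → power-bound (hits u v i j) (p≥0 i j) (p≤1 i j))) ⟩
    ∏[ i < N ] ∏[ j < N ] (p i j + (1ℚ - p i j) * pairPower u v i j 0ℚ)
      ≡⟨ prod-cong (λ i → prod-cong (λ j →
           rearrange (p i j) (pairPower u v i j 0ℚ) (select-one (hits u v i j)))) ⟩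
    ∏[ i < N ] ∏[ j < N ] (p i j * pairPower u v i j 1ℚ + ((1ℚ - p i j) * pairPower u v i j 0ℚ + 0ℚ))
      ≡⟨ allPresent-prob u v ⟨
    ∑[ G ∈ allDigraphs N ] (weight G * ι (allᶠ (λ k → G (u k) (v k)))) ∎
    where
    open QP.≤-Reasoning
    power-nonneg : ∀ i j → 0ℚ ≤ℚ pairPower u v i j (p i j)
    power-nonneg i j = prod-nonneg (λ k → select (hits u v i j k) (p i j))
                                   (λ k → select-nonneg (hits u v i j k) (p≥0 i j))
    rearrange : ∀ x z {o} → o ≡ 1ℚ → x + (1ℚ - x) * z ≡ x * o + ((1ℚ - x) * z + 0ℚ)
    rearrange x z refl =
      solve 2 (λ x z → x :+ (con 1ℚ :- x) :* z := x :* con 1ℚ :+ ((con 1ℚ :- x) :* z :+ con 0ℚ)) refl x z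

nextCyc-inject₁ : ∀ n (k : Fin n) → nextCyc {suc n} (F.inject₁ k) ≡ F.suc k
nextCyc-inject₁ n k = FP.toℕ-injective (begin
  toℕ (nextCyc {suc n} (F.inject₁ k))  ≡⟨ FP.toℕ-fromℕ< _ ⟩
  suc (toℕ (F.inject₁ k)) DM.% suc n   ≡⟨ cong (λ z → suc z DM.% suc n) (FP.toℕ-inject₁ k) ⟩
  suc (toℕ k) DM.% suc n               ≡⟨ DM.m<n⇒m%n≡m (ℕ.s≤s (FP.toℕ<n k)) ⟩
  suc (toℕ k)                          ∎)
  where open ≡-Reasoning

nextCyc-last : ∀ n → nextCyc {suc n} (F.fromℕ n) ≡ F.zero
nextCyc-last n = FP.toℕ-injective (begin
  toℕ (nextCyc {suc n} (F.fromℕ n))  ≡⟨ FP.toℕ-fromℕ< _ ⟩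
  suc (toℕ (F.fromℕ n)) DM.% suc n   ≡⟨ cong (λ z → suc z DM.% suc n) (FP.toℕ-fromℕ n) ⟩
  suc n DM.% suc n                   ≡⟨ DM.n%n≡0 (suc n) ⟩
  0                                  ∎)
  where open ≡-Reasoning

prod-rotate : ∀ n (g : Fin (suc n) → ℚ) → ∏[ k < suc n ] g (nextCyc k) ≡ ∏[ k < suc n ] g k
prod-rotate n g = begin
  ∏[ k < suc n ] g (nextCyc k)
    ≡⟨ prod-init-last (λ k → g (nextCyc k)) ⟩
  ∏[ k < n ] g (nextCyc (F.inject₁ k)) * g (nextCyc (F.fromℕ n))
    ≡⟨ cong₂ _*_ (prod-cong (λ k → cong g (nextCyc-inject₁ n k))) (cong g (nextCyc-last n)) ⟩
  ∏[ k < n ] g (F.suc k) * g F.zero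
    ≡⟨ QP.*-comm _ (g F.zero) ⟩
  ∏[ k < suc n ] g k ∎
  where open ≡-Reasoning

closed-walk-prod : ∀ {r N} .{{_ : NonZero r}} (β α : Fin N → ℚ) (t : Fin r → Fin N) →
  ∏[ k < r ] (β (t k) * α (t (nextCyc k))) ≡ ∏[ k < r ] (β (t k) * α (t k))
closed-walk-prod {suc n} β α t = begin
  ∏[ k < suc n ] (β (t k) * α (t (nextCyc k)))
    ≡⟨ prod-distrib-* (β ∘ t) (λ k → α (t (nextCyc k))) ⟩
  ∏[ k < suc n ] β (t k) * ∏[ k < suc n ] α (t (nextCyc k))
    ≡⟨ cong (∏[ k < suc n ] β (t k) *_) (prod-rotate n (α ∘ t)) ⟩
  ∏[ k < suc n ] β (t k) * ∏[ k < suc n ] α (t k)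
    ≡⟨ prod-distrib-* (β ∘ t) (α ∘ t) ⟨
  ∏[ k < suc n ] (β (t k) * α (t k)) ∎
  where open ≡-Reasoning

distinct : ∀ {n N} → (Fin n → Fin N) → Bool
distinct t = allᶠ (λ k → allᶠ (λ l → eqF k l ∨ not (eqF (t k) (t l))))

fresh : ∀ {n N} → Fin N → (Fin n → Fin N) → Bool
fresh x f = allᶠ (λ l → not (eqF (f l) x))

occ : ∀ {n N} → (Fin n → Fin N) → Fin N → ℚ
occ {n} f x = ∑[ l < n ] ι (eqF (f l) x)

distinct-cons : ∀ {n N} (t : Fin (suc n) → Fin N) →
                distinct t ≡ fresh (t F.zero) (t ∘ F.suc) ∧ distinct (t ∘ F.suc)
distinct-cons {n} t = begin
  -- distinct t unfolded: row 0 and column 0 are the two freshness conditions for t 0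
  allᶠ (λ l → not (eqF (t F.zero) (t (F.suc l)))) ∧ allᶠ (λ k → not (eqF (t (F.suc k)) (t F.zero)) ∧ row k)
    ≡⟨ cong₂ _∧_ (allᶠ-cong (λ l → cong not (eqF-sym (t F.zero) (t (F.suc l)))))
                 (allᶠ-∧ (λ k → not (eqF (t (F.suc k)) (t F.zero))) row) ⟩
  x∉f ∧ (x∉f ∧ distinct (t ∘ F.suc))
    ≡⟨ ∧-absorb x∉f (distinct (t ∘ F.suc)) ⟩
  x∉f ∧ distinct (t ∘ F.suc) ∎
  where
  open ≡-Reasoning
  x∉f : Bool
  x∉f = fresh (t F.zero) (t ∘ F.suc)
  row : Fin n → Bool
  row k = allᶠ (λ l → eqF k l ∨ not (eqF (t (F.suc k)) (t (F.suc l))))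
  ∧-absorb : ∀ a d → a ∧ (a ∧ d) ≡ a ∧ d
  ∧-absorb true  d = refl
  ∧-absorb false d = refl

distinct-≤ : ∀ {n N} (x : Fin N) (f : Fin n → Fin N) → ι (distinct f) ≤ℚ ι (fresh x f ∧ distinct f) + occ f x
distinct-≤ x f with fresh x f in x∉f
... | true  = QP.≤-trans (QP.≤-reflexive (sym (QP.+-identityʳ _)))
                         (QP.+-monoʳ-≤ (ι (distinct f)) (∑-nonneg _ (λ l → ι-nonneg (eqF (f l) x))))
... | false = QP.≤-trans (ι-≤1 (distinct f))
                         (QP.≤-trans (none-false⇒count≥1 (λ l → eqF (f l) x) x∉f)
                                     (QP.≤-reflexive (sym (QP.+-identityˡ _))))

occ-weighted : ∀ {n N} (f : Fin n → Fin N) (w : Fin N → ℚ) → ∑[ x < N ] (occ f x * w x) ≡ ∑[ l < n ] w (f l)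
occ-weighted {n} {N} f w = begin
  ∑[ x < N ] (occ f x * w x)                   ≡⟨ sum-cong-≗ {y = λ x → ∑[ l < n ] (ι (eqF (f l) x) * w x)}
                                                     (λ x → *-distribʳ-sum (w x) (λ l → ι (eqF (f l) x))) ⟩
  ∑[ x < N ] ∑[ l < n ] (ι (eqF (f l) x) * w x)  ≡⟨ ∑-comm (λ x l → ι (eqF (f l) x) * w x) ⟩
  ∑[ l < n ] ∑[ x < N ] (ι (eqF (f l) x) * w x)  ≡⟨ sum-cong-≗ {y = λ l → w (f l)} (λ l → ∑-point (f l) w) ⟩
  ∑[ l < n ] w (f l)                           ∎
  where open ≡-Reasoning

∑-const : ∀ n c → ∑[ i < n ] c ≡ (+ n) / 1 * c
∑-const zero    c = sym (QP.*-zeroˡ c)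
∑-const (suc n) c = begin
  c + ∑[ i < n ] c          ≡⟨ cong (λ z → c + z) (∑-const n c) ⟩
  c + (+ n) / 1 * c         ≡⟨ solve 2 (λ c k → c :+ k :* c := (con 1ℚ :+ k) :* c) refl c ((+ n) / 1) ⟩
  (1ℚ + (+ n) / 1) * c      ≡⟨ cong (_* c) (frac-+ 1 n 1) ⟨
  (+ suc n) / 1 * c         ∎
  where open ≡-Reasoning

choose2 : ℕ → ℚ
choose2 n = (+ (n C 2)) / 1

choose2-suc : ∀ n → choose2 (suc n) ≡ choose2 n + (+ n) / 1
choose2-suc n = begin
  (+ (suc n C 2)) / 1              ≡⟨ cong (λ z → (+ z) / 1) (nCk+nC[k+1]≡[n+1]C[k+1] n 1) ⟨
  (+ (n C 1 ℕ.+ n C 2)) / 1        ≡⟨ cong (λ z → (+ (z ℕ.+ n C 2)) / 1) (nC1≡n n) ⟩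
  (+ (n ℕ.+ n C 2)) / 1            ≡⟨ frac-+ n (n C 2) 1 ⟩
  (+ n) / 1 + choose2 n            ≡⟨ QP.+-comm ((+ n) / 1) (choose2 n) ⟩
  choose2 n + (+ n) / 1            ∎
  where open ≡-Reasoning

module InjectiveTuples {N : ℕ} (w : Fin N → ℚ) (m : ℚ)
                       (w≥0 : ∀ i → 0ℚ ≤ℚ w i) (w≤m : ∀ i → w i ≤ℚ m) where

  nodes : List (Fin N)
  nodes = allFin N

  tuples : (n : ℕ) → List (Fin n → Fin N)
  tuples n = allFunctions n nodes

  ρ : ℚ
  ρ = ∑[ i < N ] w i

  ρ≥0 : 0ℚ ≤ℚ ρ
  ρ≥0 = ∑-nonneg w w≥0

  D : ℕ → ℚ
  D n = ∑[ t ∈ tuples n ] (ι (distinct t) * ∏[ k < n ] w (t k))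

  all-tuples : ∀ n → ∑[ t ∈ tuples n ] ∏[ k < n ] w (t k) ≡ ρ ^ℚ n
  all-tuples n = begin
    ∑[ t ∈ tuples n ] ∏[ k < n ] w (t k)   ≡⟨ lsum-allFunctions-prod n nodes (λ _ → w) ⟩
    ∏[ k < n ] lsum nodes w                ≡⟨ prod-cong {n} (λ _ → lsum-allFin N w) ⟩
    ∏[ k < n ] ρ                           ≡⟨ prod-const n ρ ⟩
    ρ ^ℚ n                                 ∎
    where open ≡-Reasoning

  D-suc : ∀ n → D (suc n) ≡
          ∑[ x ∈ nodes ] ∑[ f ∈ tuples n ] (ι (fresh x f ∧ distinct f) * (w x * ∏[ k < n ] w (f k)))
  D-suc n = trans (lsum-cong (tuples (suc n)) (λ t → cong (λ b → ι b * ∏[ k < suc n ] w (t k)) (distinct-cons t)))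
                  (lsum-allFunctions-suc n nodes (λ x f → ι (fresh x f ∧ distinct f) * (w x * ∏[ k < n ] w (f k))))

  collisions : ∀ n → ∑[ x ∈ nodes ] ∑[ f ∈ tuples n ] (occ f x * (w x * ∏[ k < n ] w (f k)))
                     ≤ℚ (+ n) / 1 * m * ρ ^ℚ n
  collisions n = begin
    ∑[ x ∈ nodes ] ∑[ f ∈ tuples n ] (occ f x * (w x * W f))
      ≡⟨ lsum-comm nodes (tuples n) (λ x f → occ f x * (w x * W f)) ⟩
    ∑[ f ∈ tuples n ] ∑[ x ∈ nodes ] (occ f x * (w x * W f))
      ≡⟨ lsum-cong (tuples n) (λ f → trans (lsum-cong nodes (λ x → regroup (occ f x) (w x) (W f)))
                                           (lsum-*ˡ nodes (W f) (λ x → occ f x * w x))) ⟩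
    ∑[ f ∈ tuples n ] (W f * ∑[ x ∈ nodes ] (occ f x * w x))
      ≡⟨ lsum-cong (tuples n) (λ f → cong (W f *_) (trans (lsum-allFin N _) (occ-weighted f w))) ⟩
    ∑[ f ∈ tuples n ] (W f * ∑[ l < n ] w (f l))
      ≤⟨ lsum-mono (tuples n) (λ f → *-monoˡ-nonneg (W≥0 f)
                                        (QP.≤-trans (∑-mono _ _ (w≤m ∘ f)) (QP.≤-reflexive (∑-const n m)))) ⟩
    ∑[ f ∈ tuples n ] (W f * ((+ n) / 1 * m))
      ≡⟨ lsum-cong (tuples n) (λ f → QP.*-comm (W f) _) ⟩
    ∑[ f ∈ tuples n ] ((+ n) / 1 * m * W f)
      ≡⟨ lsum-*ˡ (tuples n) ((+ n) / 1 * m) W ⟩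
    (+ n) / 1 * m * ∑[ f ∈ tuples n ] W f
      ≡⟨ cong ((+ n) / 1 * m *_) (all-tuples n) ⟩
    (+ n) / 1 * m * ρ ^ℚ n ∎
    where
    open QP.≤-Reasoning
    W : (Fin n → Fin N) → ℚ
    W f = ∏[ k < n ] w (f k)
    W≥0 : ∀ f → 0ℚ ≤ℚ W f
    W≥0 f = prod-nonneg _ (w≥0 ∘ f)
    regroup : ∀ o x y → o * (x * y) ≡ y * (o * x)
    regroup = solve 3 (λ o x y → o :* (x :* y) := y :* (o :* x)) refl

  D-step : ∀ n → ρ * D n ≤ℚ D (suc n) + (+ n) / 1 * m * ρ ^ℚ n
  D-step n = begin
    ρ * D n
      ≡⟨ cong (_* D n) (lsum-allFin N w) ⟨
    lsum nodes w * D n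
      ≡⟨ QP.*-comm _ (D n) ⟩
    D n * lsum nodes w
      ≡⟨ lsum-*ˡ nodes (D n) w ⟨
    ∑[ x ∈ nodes ] (D n * w x)
      ≡⟨ lsum-cong nodes (λ x → trans (QP.*-comm (D n) (w x)) (sym (lsum-*ˡ (tuples n) (w x) _))) ⟩
    ∑[ x ∈ nodes ] ∑[ f ∈ tuples n ] (w x * (ι (distinct f) * W f))
      ≤⟨ lsum-mono nodes (λ x → lsum-mono (tuples n) (λ f → prepend x f)) ⟩
    ∑[ x ∈ nodes ] ∑[ f ∈ tuples n ] (ι (fresh x f ∧ distinct f) * (w x * W f) + occ f x * (w x * W f))
      ≡⟨ lsum-cong nodes (λ x → lsum-distrib-+ (tuples n) _ _) ⟩
    ∑[ x ∈ nodes ] (∑[ f ∈ tuples n ] (ι (fresh x f ∧ distinct f) * (w x * W f))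
                    + ∑[ f ∈ tuples n ] (occ f x * (w x * W f)))
      ≡⟨ lsum-distrib-+ nodes _ _ ⟩
    ∑[ x ∈ nodes ] ∑[ f ∈ tuples n ] (ι (fresh x f ∧ distinct f) * (w x * W f))
      + ∑[ x ∈ nodes ] ∑[ f ∈ tuples n ] (occ f x * (w x * W f))
      ≤⟨ QP.+-mono-≤ (QP.≤-reflexive (sym (D-suc n))) (collisions n) ⟩
    D (suc n) + (+ n) / 1 * m * ρ ^ℚ n ∎
    where
    open QP.≤-Reasoning
    W : (Fin n → Fin N) → ℚ
    W f = ∏[ k < n ] w (f k)
    prepend : ∀ x f → w x * (ι (distinct f) * W f)
                      ≤ℚ ι (fresh x f ∧ distinct f) * (w x * W f) + occ f x * (w x * W f)
    prepend x f = begin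
      w x * (ι (distinct f) * W f)
        ≡⟨ solve 3 (λ a b c → a :* (b :* c) := b :* (a :* c)) refl (w x) (ι (distinct f)) (W f) ⟩
      ι (distinct f) * (w x * W f)
        ≤⟨ *-monoʳ-nonneg (*-nonneg (w≥0 x) (prod-nonneg _ (w≥0 ∘ f))) (distinct-≤ x f) ⟩
      (ι (fresh x f ∧ distinct f) + occ f x) * (w x * W f)
        ≡⟨ QP.*-distribʳ-+ (w x * W f) (ι (fresh x f ∧ distinct f)) (occ f x) ⟩
      ι (fresh x f ∧ distinct f) * (w x * W f) + occ f x * (w x * W f) ∎

  D-bound : ∀ n → ρ ^ℚ suc n - choose2 (suc n) * m * ρ ^ℚ n ≤ℚ D (suc n)
  -- n = 0: C(1,2) = 0, and every 1-tuple is injective, so both sides equal ρ.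
  D-bound zero = QP.≤-reflexive (begin-equality
    ρ * 1ℚ - 0ℚ * m * 1ℚ
      ≡⟨ solve 2 (λ ρ m → ρ :* con 1ℚ :- con 0ℚ :* m :* con 1ℚ := ρ :* con 1ℚ) refl ρ m ⟩
    ρ ^ℚ 1                                ≡⟨ all-tuples 1 ⟨
    ∑[ t ∈ tuples 1 ] ∏[ k < 1 ] w (t k)
      ≡⟨ lsum-cong (tuples 1) (λ t → QP.*-identityˡ (∏[ k < 1 ] w (t k))) ⟨
    D 1                                   ∎)
    where open QP.≤-Reasoning
  D-bound (suc n) = begin
    ρ ^ℚ suc (suc n) - choose2 (suc (suc n)) * m * ρ ^ℚ suc n
      ≡⟨ cong (λ K → ρ ^ℚ suc (suc n) - K * m * ρ ^ℚ suc n) (choose2-suc (suc n)) ⟩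
    ρ * (ρ * X) - (choose2 (suc n) + k) * m * (ρ * X)
      ≡⟨ solve 5 (λ ρ X K k m → ρ :* (ρ :* X) :- (K :+ k) :* m :* (ρ :* X)
                               := ρ :* (ρ :* X :- K :* m :* X) :- k :* m :* (ρ :* X))
               refl ρ X (choose2 (suc n)) k m ⟩
    ρ * (ρ ^ℚ suc n - choose2 (suc n) * m * ρ ^ℚ n) - k * m * ρ ^ℚ suc n
      ≤⟨ QP.+-monoˡ-≤ (- (k * m * ρ ^ℚ suc n)) (*-monoˡ-nonneg ρ≥0 (D-bound n)) ⟩
    ρ * D (suc n) - k * m * ρ ^ℚ suc n
      ≤⟨ ≤-+⇒-≤ (D-step (suc n)) ⟩
    D (suc (suc n)) ∎
    where
    open QP.≤-Reasoning
    X : ℚ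
    X = ρ ^ℚ n
    k : ℚ
    k = (+ suc n) / 1

module ChungLu {N : ℕ} (a b : Fin N → ℕ) (S : ℕ) .{{_ : NonZero S}}
               (a*b≤S : ∀ i j → a i ℕ.* b j ≤ S) where

  p : Fin N → Fin N → ℚ
  p = prob a b S

  p≥0 : ∀ i j → 0ℚ ≤ℚ p i j
  p≥0 i j = frac-nonneg (b i ℕ.* a j) S

  p≤1 : ∀ i j → p i j ≤ℚ 1ℚ
  p≤1 i j = frac-≤1 (b i ℕ.* a j) S (subst (_≤ S) (NP.*-comm (a j) (b i)) (a*b≤S j i))

  -- p i j = (b i / S) · a j: one factor depends only on the tail i, one only on the head j
  p-split : ∀ i j → p i j ≡ (+ b i) / S * ((+ a j) / 1)
  p-split i j = frac-* (b i) (a j) S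

  w : Fin N → ℚ
  w i = p i i

  w≤pmax : ∀ i → w i ≤ℚ pmax a b S
  w≤pmax i = maxℚ-≥ _ (∈-concat⁺′ (∈-map⁺ (p i) (∈-allFin i))
                                  (∈-map⁺ (λ i → map (p i) (allFin N)) (∈-allFin i)))

  open EdgeIndependence p using (weight; allPresent-≥)
  open InjectiveTuples w (pmax a b S) (λ i → p≥0 i i) w≤pmax public using (ρ; tuples; D; D-bound)

  probDigraph≡weight : ∀ G → probDigraph a b S G ≡ weight G
  probDigraph≡weight G = prodℚ-grid N N (λ i j → if G i j then p i j else 1ℚ - p i j)

  ρ≡a·b/S : (+ dot a b) / S ≡ ρ
  ρ≡a·b/S = begin
    (+ dot a b) / S                           ≡⟨ frac-sum (λ i → a i ℕ.* b i) (allFin N) S ⟩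
    ∑[ i ∈ allFin N ] ((+ (a i ℕ.* b i)) / S)  ≡⟨ lsum-allFin N _ ⟩
    ∑[ i < N ] ((+ (a i ℕ.* b i)) / S)
      ≡⟨ sum-cong-≗ {y = w} (λ i → cong (λ z → (+ z) / S) (NP.*-comm (a i) (b i))) ⟩
    ρ                                         ∎
    where open ≡-Reasoning

  module _ (r : ℕ) .{{_ : NonZero r}} where

    cycleEdges : (Fin r → Fin N) → Digraph N → Bool
    cycleEdges t G = allᶠ (λ k → G (t k) (t (nextCyc k)))

    isSimpleCycle-split : ∀ G t → isSimpleCycle G t ≡ distinct t ∧ cycleEdges t G
    isSimpleCycle-split G t = cong₂ _∧_
      (trans (allB-allFin r (λ k → allB (row k) (allFin r))) (allᶠ-cong (λ k → allB-allFin r (row k))))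
      (allB-allFin r (λ k → G (t k) (t (nextCyc k))))
      where
      row : Fin r → Fin r → Bool
      row k l = eqF k l ∨ not (eqF (t k) (t l))

    SC≡∑ : ∀ G → (+ SC r G) / 1 ≡ ∑[ t ∈ tuples r ] ι (isSimpleCycle G t)
    SC≡∑ G = trans (frac-sum _ (tuples r) 1) (lsum-cong (tuples r) (λ t → 0/1-cast (isSimpleCycle G t)))
      where
      0/1-cast : ∀ c → (+ (if c then 1 else 0)) / 1 ≡ ι c
      0/1-cast true  = refl
      0/1-cast false = refl

    cycle-prob : ∀ t → ∏[ k < r ] p (t k) (t (nextCyc k)) ≡ ∏[ k < r ] w (t k)
    cycle-prob t = begin
      ∏[ k < r ] p (t k) (t (nextCyc k))                          ≡⟨ prod-cong (λ k → p-split (t k) (t (nextCyc k))) ⟩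
      ∏[ k < r ] ((+ b (t k)) / S * ((+ a (t (nextCyc k))) / 1))  ≡⟨ closed-walk-prod β α t ⟩
      ∏[ k < r ] ((+ b (t k)) / S * ((+ a (t k)) / 1))            ≡⟨ prod-cong (λ k → p-split (t k) (t k)) ⟨
      ∏[ k < r ] w (t k)                                         ∎
      where
      open ≡-Reasoning
      β α : Fin N → ℚ
      β i = (+ b i) / S
      α j = (+ a j) / 1

    -- E(SC_r) ≥ D r: each injective r-tuple is a cycle with probability ≥ ∏ w.
    expectedSC-≥ : D r ≤ℚ expectedSC a b S r
    expectedSC-≥ = begin
      ∑[ t ∈ tuples r ] (ι (distinct t) * ∏[ k < r ] w (t k))
        ≡⟨ lsum-cong (tuples r) (λ t → cong (ι (distinct t) *_) (cycle-prob t)) ⟨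
      ∑[ t ∈ tuples r ] (ι (distinct t) * ∏[ k < r ] p (t k) (t (nextCyc k)))
        ≤⟨ lsum-mono (tuples r) (λ t → *-monoˡ-nonneg (ι-nonneg (distinct t))
                                          (allPresent-≥ p≥0 p≤1 t (t ∘ nextCyc))) ⟩
      ∑[ t ∈ tuples r ] (ι (distinct t) * ∑[ G ∈ Gs ] (weight G * ι (cycleEdges t G)))
        ≡⟨ lsum-cong (tuples r) (λ t → trans (sym (lsum-*ˡ Gs (ι (distinct t)) _))
             (lsum-cong Gs (λ G → trans (pull-indicator (weight G) (distinct t) (cycleEdges t G))
                                        (cong (λ c → weight G * ι c) (sym (isSimpleCycle-split G t)))))) ⟩
      ∑[ t ∈ tuples r ] ∑[ G ∈ Gs ] (weight G * ι (isSimpleCycle G t))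
        ≡⟨ lsum-comm Gs (tuples r) (λ G t → weight G * ι (isSimpleCycle G t)) ⟨
      ∑[ G ∈ Gs ] ∑[ t ∈ tuples r ] (weight G * ι (isSimpleCycle G t))
        ≡⟨ lsum-cong Gs (λ G → trans (lsum-*ˡ (tuples r) (weight G) _)
                                     (cong₂ _*_ (sym (probDigraph≡weight G)) (sym (SC≡∑ G)))) ⟩
      expectedSC a b S r ∎
      where
      open QP.≤-Reasoning
      Gs : List (Digraph N)
      Gs = allDigraphs N
      pull-indicator : ∀ x c e → ι c * (x * ι e) ≡ x * ι (c ∧ e)
      pull-indicator x c e = trans (solve 3 (λ x c e → c :* (x :* e) := x :* (c :* e)) refl x (ι c) (ι e))
                                   (cong (x *_) (sym (ι-∧ c e)))

lemma5 : (N : ℕ) (a b : Fin N → ℕ)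
         → totalS a ≡ totalS b
         → .{{_ : NonZero (totalS a)}}
         → (∀ i j → a i ℕ.* b j ≤ totalS a)
         → (r : ℕ) .{{_ : NonZero r}}
         → let S = totalS a
               ρ = (+ dot a b) / S
           in (ρ ^ℚ r) - (((+ (r C 2)) / 1) * pmax a b S * (ρ ^ℚ (r ∸ 1)))
                ≤ℚ expectedSC a b S r
lemma5 N a b _ a*b≤S (suc n) = begin
  a·b/S ^ℚ suc n - choose2 (suc n) * pmax a b (totalS a) * a·b/S ^ℚ n
    ≡⟨ cong (λ x → x ^ℚ suc n - choose2 (suc n) * pmax a b (totalS a) * x ^ℚ n) ρ≡a·b/S ⟩
  ρ ^ℚ suc n - choose2 (suc n) * pmax a b (totalS a) * ρ ^ℚ n
    ≤⟨ D-bound n ⟩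
  D (suc n)
    ≤⟨ expectedSC-≥ (suc n) ⟩
  expectedSC a b (totalS a) (suc n) ∎
  where
  open QP.≤-Reasoning
  open ChungLu a b (totalS a) a*b≤S
  a·b/S : ℚ
  a·b/S = (+ dot a b) / totalS a
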